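{- Let $k\ge 4$ be an integer with $k\not\equiv 0\pmod{4}$. Then for each choice of the sign $\pm$, the Diophantine equation $x^3\pm y^3=a^k-b^k$ has infinitely many nontrivial solutions $(x,y,a,b)$ in positive integers.
   Context: A quadruple $(x,y,a,b)$ of integers is called a nontrivial solution of an equation $x^3\pm y^3=a^k\pm b^k$ (signs fixed) if $\gcd(x,y,a,b)=1$ and no partial sum in the expression $x^3\pm y^3-(a^k\pm b^k)$ vanishes. -}

module Defs where

open import Data.Nat as ℕ using (ℕ; zero; suc; _%_; _>_; _≥_; _+_)
open import Data.Nat.GCD using (gcd)
open import Data.Integer as ℤ using (ℤ; +_; -_)
open import Data.Bool using (Bool; true; false; if_then_else_)
open import Data.Fin using (Fin)
open import Data.Vec using (Vec; []; _∷_; zipWith; foldr)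
open import Data.Fin.Subset using (Subset; ⊤) renaming (⊥ to ∅)
open import Data.Product using (_×_)
open import Relation.Binary.PropositionalEquality using (_≡_; _≢_)

data PM : Set where
  plus minus : PM

applySign : PM → ℤ → ℤ
applySign plus  z = z
applySign minus z = - z

-- the four terms of  x³ ± y³ − (aᵏ − bᵏ) = x³ + (±y³) + (−aᵏ) + bᵏ
terms : PM → ℕ → ℕ → ℕ → ℕ → ℕ → Vec ℤ 4
terms σ k x y a b =
  (+ (x ℕ.^ 3)) ∷ applySign σ (+ (y ℕ.^ 3)) ∷ (- (+ (a ℕ.^ k))) ∷ (+ (b ℕ.^ k)) ∷ []

subSum : ∀ {n} → Subset n → Vec ℤ n → ℤ
subSum S v = foldr _ ℤ._+_ (+ 0) (zipWith (λ s t → if s then t else + 0) S v)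

IsSolution : PM → ℕ → ℕ → ℕ → ℕ → ℕ → Set
IsSolution σ k x y a b =
  (+ (x ℕ.^ 3)) ℤ.+ applySign σ (+ (y ℕ.^ 3)) ≡ (+ (a ℕ.^ k)) ℤ.- (+ (b ℕ.^ k))

IsNontrivial : PM → ℕ → ℕ → ℕ → ℕ → ℕ → Set
IsNontrivial σ k x y a b =
  gcd (gcd (gcd x y) a) b ≡ 1 ×
  (∀ (S : Subset 4) → S ≢ ∅ → S ≢ ⊤ → subSum S (terms σ k x y a b) ≢ + 0)

-- Two polynomial identities,
--   (1 + 9t³)³ + 3⁶t¹² = (3t + 9t⁴)³ + 1   and   X(v)³ + Y(v)³ + 1 = 3⁶(1 + v)¹²
-- (X, Y explicit polynomials), turn every k-th power of the form 3⁶t¹² into a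
-- solution with a = 1 (sign −) or b = 1 (sign +).  When 4 ∤ k there are arbitrarily
-- large such powers: some m has mk = 6 + 12j, and then c = 3ᵐw¹² satisfies
-- cᵏ = 3⁶(3ʲwᵏ)¹².  Nontriviality is cheap: a or b equals 1, and since the four
-- terms sum to zero a partial sum vanishes only if a singleton or a pair
-- containing x³ does.
module Submission where

open import Defs
open import Data.Bool using (true; false)
open import Data.Fin using (Fin; zero; suc; #_)
open import Data.Fin.Subset using (Subset; ⊤; ⁅_⁆; ∁) renaming (⊥ to ∅)
open import Data.Nat as ℕ using (ℕ; zero; suc; _%_; _≥_; _>_; _≤_; _<_; _^_; z≤n; s≤s)
open import Data.Nat.GCD using (gcd; gcd-zeroˡ; gcd-zeroʳ)
open import Data.Product using (_×_; _,_; ∃₂; ∃-syntax)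
open import Data.Sum using (inj₁; inj₂)
open import Data.Vec using (Vec; []; _∷_; lookup)
open import Function using (_∘_)
open import Relation.Binary.PropositionalEquality using (_≡_; _≢_; refl; sym; trans; cong; cong₂)
open import Relation.Nullary using (contradiction)
open Relation.Binary.PropositionalEquality.≡-Reasoning

module _ where
  open import Data.Integer using (ℤ; 0ℤ; +_; -_; _+_; _-_)
  import Data.Integer.Properties as ℤ
  open import Data.Integer.Tactic.RingSolver using (solve-∀)
  open import Data.Nat.Properties using (m<n⇒n≢0; m+n≡0⇒m≡0; m^n≡0⇒m≡0)

  subSum-∅ : ∀ {n} (v : Vec ℤ n) → subSum ∅ v ≡ 0ℤ
  subSum-∅ []      = refl
  subSum-∅ (t ∷ v) = trans (ℤ.+-identityˡ _) (subSum-∅ v)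

  subSum-⁅⁆ : ∀ {n} (i : Fin n) (v : Vec ℤ n) → subSum ⁅ i ⁆ v ≡ lookup v i
  subSum-⁅⁆ zero    (t ∷ v) = trans (cong (_+_ t) (subSum-∅ v)) (ℤ.+-identityʳ t)
  subSum-⁅⁆ (suc i) (t ∷ v) = trans (ℤ.+-identityˡ _) (subSum-⁅⁆ i v)

  subSum-∁ : ∀ {n} (S : Subset n) (v : Vec ℤ n) → subSum S v + subSum (∁ S) v ≡ subSum ⊤ v
  subSum-∁ []          []      = refl
  subSum-∁ (true ∷ S)  (t ∷ v) =
    trans (regroup t (subSum S v) (subSum (∁ S) v)) (cong (_+_ t) (subSum-∁ S v))
    where
    regroup : ∀ t X Y → (t + X) + (0ℤ + Y) ≡ t + (X + Y)
    regroup = solve-∀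
  subSum-∁ (false ∷ S) (t ∷ v) =
    trans (regroup t (subSum S v) (subSum (∁ S) v)) (cong (_+_ t) (subSum-∁ S v))
    where
    regroup : ∀ t X Y → (0ℤ + X) + (t + Y) ≡ t + (X + Y)
    regroup = solve-∀

  proper-subSum≢0 : ∀ p (w : Vec ℤ 3) → subSum ⊤ (p ∷ w) ≡ 0ℤ →
    (∀ i → lookup (p ∷ w) i ≢ 0ℤ) → (∀ i → p + lookup w i ≢ 0ℤ) →
    ∀ S → S ≢ ∅ → S ≢ ⊤ → subSum S (p ∷ w) ≢ 0ℤ
  proper-subSum≢0 p w total≡0 v[i]≢0 p+w[i]≢0 = proper
    where
    v : Vec ℤ 4
    v = p ∷ w

    singleton : ∀ i → subSum ⁅ i ⁆ v ≢ 0ℤ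
    singleton i = v[i]≢0 i ∘ trans (sym (subSum-⁅⁆ i v))

    pair : ∀ i → subSum (true ∷ ⁅ i ⁆) v ≢ 0ℤ
    pair i = p+w[i]≢0 i ∘ trans (cong (_+_ p) (sym (subSum-⁅⁆ i w)))

    complement : ∀ S → subSum S v ≢ 0ℤ → subSum (∁ S) v ≢ 0ℤ
    complement S ΣS≢0 Σ∁S≡0 = ΣS≢0 (begin
      subSum S v                   ≡⟨ sym (ℤ.+-identityʳ _) ⟩
      subSum S v + 0ℤ              ≡⟨ cong (_+_ (subSum S v)) (sym Σ∁S≡0) ⟩
      subSum S v + subSum (∁ S) v  ≡⟨ subSum-∁ S v ⟩
      subSum ⊤ v                   ≡⟨ total≡0 ⟩
      0ℤ                           ∎)

    co-singleton : ∀ i → subSum (∁ ⁅ i ⁆) v ≢ 0ℤ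
    co-singleton i = complement ⁅ i ⁆ (singleton i)

    co-pair : ∀ i → subSum (∁ (true ∷ ⁅ i ⁆)) v ≢ 0ℤ
    co-pair i = complement (true ∷ ⁅ i ⁆) (pair i)

    proper : ∀ S → S ≢ ∅ → S ≢ ⊤ → subSum S v ≢ 0ℤ
    proper (false ∷ false ∷ false ∷ false ∷ []) S≢∅ _ = contradiction refl S≢∅
    proper (true  ∷ true  ∷ true  ∷ true  ∷ []) _ S≢⊤ = contradiction refl S≢⊤
    proper (true  ∷ false ∷ false ∷ false ∷ []) _ _ = singleton (# 0)
    proper (false ∷ true  ∷ false ∷ false ∷ []) _ _ = singleton (# 1)
    proper (false ∷ false ∷ true  ∷ false ∷ []) _ _ = singleton (# 2)
    proper (false ∷ false ∷ false ∷ true  ∷ []) _ _ = singleton (# 3)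
    proper (true  ∷ true  ∷ false ∷ false ∷ []) _ _ = pair (# 0)
    proper (true  ∷ false ∷ true  ∷ false ∷ []) _ _ = pair (# 1)
    proper (true  ∷ false ∷ false ∷ true  ∷ []) _ _ = pair (# 2)
    proper (false ∷ true  ∷ true  ∷ true  ∷ []) _ _ = co-singleton (# 0)
    proper (true  ∷ false ∷ true  ∷ true  ∷ []) _ _ = co-singleton (# 1)
    proper (true  ∷ true  ∷ false ∷ true  ∷ []) _ _ = co-singleton (# 2)
    proper (true  ∷ true  ∷ true  ∷ false ∷ []) _ _ = co-singleton (# 3)
    proper (false ∷ false ∷ true  ∷ true  ∷ []) _ _ = co-pair (# 0)
    proper (false ∷ true  ∷ false ∷ true  ∷ []) _ _ = co-pair (# 1)
    proper (false ∷ true  ∷ true  ∷ false ∷ []) _ _ = co-pair (# 2)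

  p+s≡r+q⇒p-q≡r-s : ∀ {p q r s} → p + s ≡ r + q → p - q ≡ r - s
  p+s≡r+q⇒p-q≡r-s {p} {q} {r} {s} eq = begin
    p - q              ≡⟨ shift p q s ⟩
    (p + s) - (q + s)  ≡⟨ cong (_- (q + s)) eq ⟩
    (r + q) - (q + s)  ≡⟨ cancel r q s ⟩
    r - s              ∎
    where
    shift : ∀ p q s → p - q ≡ (p + s) - (q + s)
    shift = solve-∀
    cancel : ∀ r q s → (r + q) - (q + s) ≡ r - s
    cancel = solve-∀

  p+s≡r⇒p≡r-s : ∀ {p r s} → p + s ≡ r → p ≡ r - s
  p+s≡r⇒p≡r-s {p} {r} {s} eq = trans (shift p s) (cong (_- s) eq)
    where
    shift : ∀ p s → p ≡ (p + s) - s
    shift = solve-∀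

  minus-solution : ∀ k x y a b → x ^ 3 ℕ.+ b ^ k ≡ a ^ k ℕ.+ y ^ 3 → IsSolution minus k x y a b
  minus-solution k x y a b eq =
    p+s≡r+q⇒p-q≡r-s {+ (x ^ 3)} {+ (y ^ 3)} {+ (a ^ k)} {+ (b ^ k)} (cong (+_) eq)

  plus-solution : ∀ k x y a b → x ^ 3 ℕ.+ y ^ 3 ℕ.+ b ^ k ≡ a ^ k → IsSolution plus k x y a b
  plus-solution k x y a b eq =
    p+s≡r⇒p≡r-s {+ (x ^ 3 ℕ.+ y ^ 3)} {+ (a ^ k)} {+ (b ^ k)} (cong (+_) eq)

  +[m^n]≢0 : ∀ {m} n → m ≥ 1 → + (m ^ n) ≢ 0ℤ
  +[m^n]≢0 {m} n m≥1 = m<n⇒n≢0 m≥1 ∘ m^n≡0⇒m≡0 m n ∘ ℤ.+-injective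

  applySign-≢0 : ∀ σ {z} → z ≢ 0ℤ → applySign σ z ≢ 0ℤ
  applySign-≢0 plus  z≢0 = z≢0
  applySign-≢0 minus z≢0 = z≢0 ∘ ℤ.neg-injective {j = 0ℤ}

  solution-isNontrivial : ∀ σ k x y a b → IsSolution σ k x y a b →
    x ≥ 1 → y ≥ 1 → a ≥ 1 → b ≥ 1 → gcd (gcd (gcd x y) a) b ≡ 1 →
    a ^ k ≢ b ^ k → x ^ 3 ≢ a ^ k → IsNontrivial σ k x y a b
  solution-isNontrivial σ k x y a b sol x≥1 y≥1 a≥1 b≥1 coprime aᵏ≢bᵏ x³≢aᵏ =
    coprime , proper-subSum≢0 X (±Y ∷ - A ∷ B ∷ []) total≡0 term≢0 X+term≢0
    where
    X ±Y A B : ℤ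
    X  = + (x ^ 3)
    ±Y = applySign σ (+ (y ^ 3))
    A  = + (a ^ k)
    B  = + (b ^ k)

    total≡0 : X + (±Y + (- A + (B + 0ℤ))) ≡ 0ℤ
    total≡0 = begin
      X + (±Y + (- A + (B + 0ℤ)))  ≡⟨ regroup X ±Y A B ⟩
      (X + ±Y) - (A - B)           ≡⟨ cong (_- (A - B)) sol ⟩
      (A - B) - (A - B)            ≡⟨ ℤ.+-inverseʳ (A - B) ⟩
      0ℤ                           ∎
      where
      regroup : ∀ X Y A B → X + (Y + (- A + (B + 0ℤ))) ≡ (X + Y) - (A - B)
      regroup = solve-∀

    term≢0 : ∀ i → lookup (X ∷ ±Y ∷ - A ∷ B ∷ []) i ≢ 0ℤ
    term≢0 zero                   = +[m^n]≢0 3 x≥1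
    term≢0 (suc zero)             = applySign-≢0 σ (+[m^n]≢0 3 y≥1)
    term≢0 (suc (suc zero))       = applySign-≢0 minus (+[m^n]≢0 k a≥1)
    term≢0 (suc (suc (suc zero))) = +[m^n]≢0 k b≥1

    X+term≢0 : ∀ i → X + lookup (±Y ∷ - A ∷ B ∷ []) i ≢ 0ℤ
    X+term≢0 zero             = aᵏ≢bᵏ ∘ ℤ.+-injective ∘ ℤ.i-j≡0⇒i≡j A B ∘ trans (sym sol)
    X+term≢0 (suc zero)       = x³≢aᵏ ∘ ℤ.+-injective ∘ ℤ.i-j≡0⇒i≡j X A
    X+term≢0 (suc (suc zero)) = +[m^n]≢0 3 x≥1 ∘ cong (+_) ∘ m+n≡0⇒m≡0 (x ^ 3) ∘ ℤ.+-injective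

open import Data.Nat using (_+_; _*_)
open import Data.Nat.Properties
  using (≤-trans; ≤-reflexive; <-≤-trans; ≤-<-trans; <⇒≢; m≤m+n; m≤n+m; m<m+n; m≤m*n; m≤n*m;
         *-comm; *-assoc; m*n≡1⇒m≡1; m*n≢0;
         ^-zeroˡ; ^-*-assoc; ^-distribˡ-+-*; m^n≡1⇒n≡0∨m≡1; m^n≢0)
open import Data.Nat.Solver using (module +-*-Solver)
open import Data.Nat.Tactic.RingSolver using (solve-∀)
open +-*-Solver using (solve; _:+_; _:*_; _:^_; _:=_; con)

k%4≢0⇒m*k≡6+12j : ∀ k → k % 4 ≢ 0 → ∃₂ λ m j → m * k ≡ 6 + 12 * j
k%4≢0⇒m*k≡6+12j 0  k%4≢0 = contradiction refl k%4≢0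
k%4≢0⇒m*k≡6+12j 1  _     = 6 , 0 , refl
k%4≢0⇒m*k≡6+12j 2  _     = 3 , 0 , refl
k%4≢0⇒m*k≡6+12j 3  _     = 2 , 0 , refl
k%4≢0⇒m*k≡6+12j 4  k%4≢0 = contradiction refl k%4≢0
k%4≢0⇒m*k≡6+12j 5  _     = 6 , 2 , refl
k%4≢0⇒m*k≡6+12j 6  _     = 1 , 0 , refl
k%4≢0⇒m*k≡6+12j 7  _     = 6 , 3 , refl
k%4≢0⇒m*k≡6+12j 8  k%4≢0 = contradiction refl k%4≢0
k%4≢0⇒m*k≡6+12j 9  _     = 2 , 1 , refl
k%4≢0⇒m*k≡6+12j 10 _     = 3 , 2 , refl
k%4≢0⇒m*k≡6+12j 11 _     = 6 , 5 , refl
-- (12 + k) % 4 reduces to k % 4, so the hypothesis passes to the recursive call unchanged.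
k%4≢0⇒m*k≡6+12j (suc (suc (suc (suc (suc (suc (suc (suc (suc (suc (suc (suc k)))))))))))) k%4≢0
  with k%4≢0⇒m*k≡6+12j k k%4≢0
... | m , j , m*k≡6+12j = m , j + m , (begin
  m * (12 + k)           ≡⟨ distrib m k ⟩
  12 * m + m * k         ≡⟨ cong (12 * m +_) m*k≡6+12j ⟩
  12 * m + (6 + 12 * j)  ≡⟨ regroup m j ⟩
  6 + 12 * (j + m)       ∎)
  where
  distrib : ∀ m k → m * (12 + k) ≡ 12 * m + m * k
  distrib = solve-∀
  regroup : ∀ m j → 12 * m + (6 + 12 * j) ≡ 6 + 12 * (j + m)
  regroup = solve-∀

[m*n]^o≡m^o*n^o : ∀ m n o → (m * n) ^ o ≡ m ^ o * n ^ o
[m*n]^o≡m^o*n^o m n zero    = refl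
[m*n]^o≡m^o*n^o m n (suc o) =
  trans (cong (m * n *_) ([m*n]^o≡m^o*n^o m n o)) (interchange m n (m ^ o) (n ^ o))
  where
  interchange : ∀ a b c d → a * b * (c * d) ≡ a * c * (b * d)
  interchange = solve-∀

[g^m*w^12]^k≡g^6*[g^j*w^k]^12 : ∀ g w m j k → m * k ≡ 6 + 12 * j →
  (g ^ m * w ^ 12) ^ k ≡ g ^ 6 * (g ^ j * w ^ k) ^ 12
[g^m*w^12]^k≡g^6*[g^j*w^k]^12 g w m j k m*k≡6+12j = begin
  (g ^ m * w ^ 12) ^ k          ≡⟨ [m*n]^o≡m^o*n^o (g ^ m) (w ^ 12) k ⟩
  (g ^ m) ^ k * (w ^ 12) ^ k    ≡⟨ cong₂ _*_ (^-*-assoc g m k) (^-*-assoc w 12 k) ⟩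
  g ^ (m * k) * w ^ (12 * k)    ≡⟨ cong (λ e → g ^ e * w ^ (12 * k)) m*k≡6+12j ⟩
  g ^ (6 + 12 * j) * w ^ (12 * k)
    ≡⟨ cong (_* w ^ (12 * k)) (^-distribˡ-+-* g 6 (12 * j)) ⟩
  g ^ 6 * g ^ (12 * j) * w ^ (12 * k)
    ≡⟨ *-assoc (g ^ 6) (g ^ (12 * j)) (w ^ (12 * k)) ⟩
  g ^ 6 * (g ^ (12 * j) * w ^ (12 * k))
    ≡⟨ cong₂ (λ e f → g ^ 6 * (g ^ e * w ^ f)) (*-comm 12 j) (*-comm 12 k) ⟩
  g ^ 6 * (g ^ (j * 12) * w ^ (k * 12))
    ≡⟨ cong (g ^ 6 *_) (sym (cong₂ _*_ (^-*-assoc g j 12) (^-*-assoc w k 12))) ⟩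
  g ^ 6 * ((g ^ j) ^ 12 * (w ^ k) ^ 12)
    ≡⟨ cong (g ^ 6 *_) (sym ([m*n]^o≡m^o*n^o (g ^ j) (w ^ k) 12)) ⟩
  g ^ 6 * (g ^ j * w ^ k) ^ 12  ∎

n≤g^m*n^12 : ∀ g m n .{{_ : ℕ.NonZero g}} .{{_ : ℕ.NonZero n}} → n ≤ g ^ m * n ^ 12
n≤g^m*n^12 g m n =
  ≤-trans (m≤m*n n (n ^ 11) {{m^n≢0 n 11}}) (m≤n*m (n ^ 12) (g ^ m) {{m^n≢0 g m}})

large-c^k≡729*t^12 : ∀ k → k % 4 ≢ 0 → ∀ w .{{_ : ℕ.NonZero w}} →
  ∃₂ λ c t → w ≤ c × t ≥ 1 × c ^ k ≡ 729 * t ^ 12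
large-c^k≡729*t^12 k k%4≢0 w with k%4≢0⇒m*k≡6+12j k k%4≢0
... | m , j , m*k≡6+12j =
  3 ^ m * w ^ 12 , t , n≤g^m*n^12 3 m w , t≥1 , [g^m*w^12]^k≡g^6*[g^j*w^k]^12 3 w m j k m*k≡6+12j
  where
  t : ℕ
  t = 3 ^ j * w ^ k

  t≥1 : t ≥ 1
  t≥1 = ℕ.>-nonZero⁻¹ t {{m*n≢0 (3 ^ j) (w ^ k) {{m^n≢0 3 j}} {{m^n≢0 w k}}}}

minus-identity : ∀ t → (1 + 9 * t ^ 3) ^ 3 + 729 * t ^ 12 ≡ 1 + (3 * t + 9 * t ^ 4) ^ 3
minus-identity = solve 1 (λ t →
  (con 1 :+ con 9 :* t :^ 3) :^ 3 :+ con 729 :* t :^ 12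
    := con 1 :+ (con 3 :* t :+ con 9 :* t :^ 4) :^ 3) refl

plus-identity : ∀ v →
  (8 + 27 * v + 27 * v ^ 2 + 9 * v ^ 3) ^ 3 + (6 + 33 * v + 54 * v ^ 2 + 36 * v ^ 3 + 9 * v ^ 4) ^ 3 + 1
    ≡ 729 * (1 + v) ^ 12
plus-identity = solve 1 (λ v →
  (con 8 :+ con 27 :* v :+ con 27 :* v :^ 2 :+ con 9 :* v :^ 3) :^ 3
    :+ (con 6 :+ con 33 :* v :+ con 54 :* v :^ 2 :+ con 36 :* v :^ 3 :+ con 9 :* v :^ 4) :^ 3 :+ con 1
    := con 729 :* (con 1 :+ v) :^ 12) refl

729*n≢1 : ∀ n → 729 * n ≢ 1
729*n≢1 n 729*n≡1 with m*n≡1⇒m≡1 729 n 729*n≡1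
... | ()

LargeNontrivialSolution : PM → ℕ → ℕ → Set
LargeNontrivialSolution σ k N = ∃[ x ] ∃[ y ] ∃[ a ] ∃[ b ]
  (x ≥ 1 × y ≥ 1 × a ≥ 1 × b ≥ 1 × x + y + a + b > N ×
   IsSolution σ k x y a b × IsNontrivial σ k x y a b)

solutions-from-c^k≡729*t^12 : ∀ σ {k N c t} → N < c → t ≥ 1 → c ^ k ≡ 729 * t ^ 12 →
  LargeNontrivialSolution σ k N
solutions-from-c^k≡729*t^12 σ {t = zero} _ () _
solutions-from-c^k≡729*t^12 minus {k} {N} {c} {t@(suc _)} N<c _ cᵏ≡729t¹² =
  x , y , 1 , c , s≤s z≤n , s≤s z≤n , s≤s z≤n , c≥1 , <-≤-trans N<c (m≤n+m c (x + y + 1)) , sol ,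
  solution-isNontrivial minus k x y 1 c sol (s≤s z≤n) (s≤s z≤n) (s≤s z≤n) c≥1 gcd≡1 1ᵏ≢cᵏ x³≢1ᵏ
  where
  x y : ℕ
  x = 1 + 9 * t ^ 3
  y = 3 * t + 9 * t ^ 4

  c≥1 : c ≥ 1
  c≥1 = ≤-trans (s≤s z≤n) N<c

  sol : IsSolution minus k x y 1 c
  sol = minus-solution k x y 1 c (begin
    x ^ 3 + c ^ k         ≡⟨ cong (x ^ 3 +_) cᵏ≡729t¹² ⟩
    x ^ 3 + 729 * t ^ 12  ≡⟨ minus-identity t ⟩
    1 + y ^ 3             ≡⟨ cong (_+ y ^ 3) (sym (^-zeroˡ k)) ⟩
    1 ^ k + y ^ 3         ∎)

  gcd≡1 : gcd (gcd (gcd x y) 1) c ≡ 1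
  gcd≡1 = trans (cong (λ g → gcd g c) (gcd-zeroʳ (gcd x y))) (gcd-zeroˡ c)

  1ᵏ≢cᵏ : 1 ^ k ≢ c ^ k
  1ᵏ≢cᵏ 1ᵏ≡cᵏ = 729*n≢1 (t ^ 12) (trans (sym cᵏ≡729t¹²) (trans (sym 1ᵏ≡cᵏ) (^-zeroˡ k)))

  x³≢1ᵏ : x ^ 3 ≢ 1 ^ k
  x³≢1ᵏ x³≡1ᵏ with m^n≡1⇒n≡0∨m≡1 x 3 (trans x³≡1ᵏ (^-zeroˡ k))
  ... | inj₁ ()
  ... | inj₂ ()
solutions-from-c^k≡729*t^12 plus {k} {N} {c} {t@(suc v)} N<c _ cᵏ≡729t¹² =
  x , y , c , 1 , s≤s z≤n , s≤s z≤n , c≥1 , s≤s z≤n ,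
  <-≤-trans N<c (≤-trans (m≤n+m c (x + y)) (m≤m+n (x + y + c) 1)) , sol ,
  solution-isNontrivial plus k x y c 1 sol (s≤s z≤n) (s≤s z≤n) c≥1 (s≤s z≤n)
    (gcd-zeroʳ (gcd (gcd x y) c)) cᵏ≢1ᵏ x³≢cᵏ
  where
  x y : ℕ
  x = 8 + 27 * v + 27 * v ^ 2 + 9 * v ^ 3
  y = 6 + 33 * v + 54 * v ^ 2 + 36 * v ^ 3 + 9 * v ^ 4

  c≥1 : c ≥ 1
  c≥1 = ≤-trans (s≤s z≤n) N<c

  x³+y³+1≡cᵏ : x ^ 3 + y ^ 3 + 1 ≡ c ^ k
  x³+y³+1≡cᵏ = trans (plus-identity v) (sym cᵏ≡729t¹²)

  sol : IsSolution plus k x y c 1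
  sol = plus-solution k x y c 1 (begin
    x ^ 3 + y ^ 3 + 1 ^ k  ≡⟨ cong (x ^ 3 + y ^ 3 +_) (^-zeroˡ k) ⟩
    x ^ 3 + y ^ 3 + 1      ≡⟨ x³+y³+1≡cᵏ ⟩
    c ^ k                  ∎)

  cᵏ≢1ᵏ : c ^ k ≢ 1 ^ k
  cᵏ≢1ᵏ cᵏ≡1ᵏ = 729*n≢1 (t ^ 12) (trans (sym cᵏ≡729t¹²) (trans cᵏ≡1ᵏ (^-zeroˡ k)))

  x³≢cᵏ : x ^ 3 ≢ c ^ k
  x³≢cᵏ = <⇒≢ (≤-<-trans (m≤m+n (x ^ 3) (y ^ 3))
                (<-≤-trans (m<m+n (x ^ 3 + y ^ 3) ℕ.z<s) (≤-reflexive x³+y³+1≡cᵏ)))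

mainTheorem6 : (k : ℕ) → k ≥ 4 → k % 4 ≢ 0 → (σ : PM) → (N : ℕ) →
    ∃[ x ] ∃[ y ] ∃[ a ] ∃[ b ]
      (x ≥ 1 × y ≥ 1 × a ≥ 1 × b ≥ 1 ×
       x + y + a + b > N ×
       IsSolution σ k x y a b × IsNontrivial σ k x y a b)
mainTheorem6 k _ k%4≢0 σ N =
  let c , t , N<c , t≥1 , cᵏ≡729t¹² = large-c^k≡729*t^12 k k%4≢0 (suc N)
  in  solutions-from-c^k≡729*t^12 σ {k} N<c t≥1 cᵏ≡729t¹²
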